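{- Let $a,b$ be positive integers and consider the following infinite full-information game between Alice and Bob. Alice builds $a$ sequences of natural numbers and Bob builds $b$ sequences of natural numbers; initially all are empty. The players alternate turns; on a turn a player may either skip or extend any one of their own sequences by appending one natural number. In the limit, each player has finitely or infinitely long sequences. Bob wins if one of his infinite sequences exceeds (termwise, strictly, at every index) every infinite sequence of Alice; otherwise Alice wins. Then: (1) if $b\ge 2^a$, Bob has a winning strategy; (2) if $b<2^a$, Alice has a winning strategy.
   Context: An infinite sequence $(x_k)$ exceeds an infinite sequence $(y_k)$ if $x_k>y_k$ for all $k$. Finite (including empty) sequences in the limit play no role in determining the winner except that Bob's winning sequence must be infinite. In particular, if Alice has no infinite sequence in the limit, Bob wins as soon as he has at least one infinite sequence. -}

module Defs where

open import Data.Nat using (ℕ; zero; suc; _+_; _<_)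
open import Data.Fin using (Fin; _≟_)
open import Data.Maybe using (Maybe; just; nothing)
open import Data.Product using (_×_; _,_; ∃; ∃-syntax)
open import Data.Empty using (⊥)
open import Data.List using (List; []; _∷_)
open import Relation.Binary.PropositionalEquality using (_≡_)
open import Relation.Nullary using (yes; no)

-- A move of a player owning m sequences:
--   nothing       = skip
--   just (i , v)  = append the natural number v to sequence i
Move : ℕ → Set
Move m = Maybe (Fin m × ℕ)

MoveStream : ℕ → Set
MoveStream m = ℕ → Move m

hit : ∀ {m} → Fin m → Move m → ℕ
hit i nothing = 0
hit i (just (j , _)) with i ≟ j
... | yes _ = 1
... | no  _ = 0

-- number of entries appended to sequence i during rounds 0 .. t-1
count : ∀ {m} → MoveStream m → Fin m → ℕ → ℕ
count s i zero    = 0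
count s i (suc t) = count s i t + hit i (s t)

-- In the limit, the k-th entry (0-based) of sequence i is v.
ElemAt : ∀ {m} → MoveStream m → Fin m → ℕ → ℕ → Set
ElemAt s i k v = ∃[ t ] (s t ≡ just (i , v) × count s i t ≡ k)

Infinite : ∀ {m} → MoveStream m → Fin m → Set
Infinite s i = ∀ k → ∃[ v ] ElemAt s i k v

Exceeds : ∀ {m n} → MoveStream m → Fin m → MoveStream n → Fin n → Set
Exceeds s j s' i = ∀ k v w → ElemAt s j k v → ElemAt s' i k w → w < v

BobWins : ∀ {a b} → MoveStream a → MoveStream b → Set
BobWins {a} {b} sA sB =
  ∃[ j ] (Infinite sB j × (∀ (i : Fin a) → Infinite sA i → Exceeds sB j sA i))

-- Game with rounds: in round r Alice moves first, then Bob.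
-- History: list of completed rounds (most recent first).
History : ℕ → ℕ → Set
History a b = List (Move a × Move b)

AliceStrategy : ℕ → ℕ → Set
AliceStrategy a b = History a b → Move a

BobStrategy : ℕ → ℕ → Set
BobStrategy a b = History a b → Move a → Move b

module Play {a b : ℕ} (σA : AliceStrategy a b) (σB : BobStrategy a b) where
  hist : ℕ → History a b
  aliceMoves : MoveStream a
  bobMoves : MoveStream b
  aliceMoves r = σA (hist r)
  bobMoves r = σB (hist r) (aliceMoves r)
  hist zero = []
  hist (suc r) = (aliceMoves r , bobMoves r) ∷ hist r

BobWinsPlay : ∀ {a b} → AliceStrategy a b → BobStrategy a b → Set
BobWinsPlay σA σB = BobWins (Play.aliceMoves σA σB) (Play.bobMoves σA σB)

BobHasWinningStrategy : ℕ → ℕ → Set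
BobHasWinningStrategy a b =
  ∃[ σB ] (∀ (σA : AliceStrategy a b) → BobWinsPlay σA σB)

AliceHasWinningStrategy : ℕ → ℕ → Set
AliceHasWinningStrategy a b =
  ∃[ σA ] (∀ (σB : BobStrategy a b) → (BobWinsPlay σA σB → ⊥))

module Submission where

-- (1) b ≥ 2^a.  Bob labels 2^a of his sequences by the patterns Fin a → Fin 2 (via the
-- library bijection funToFin / finToFun) and serves the labels in cyclic order.  The
-- sequence with pattern P is extended only when it is shorter than every Alice sequence
-- that P marks, and always by 1 + (sum of all values Alice has played).  The sequence
-- whose pattern marks exactly Alice's infinite sequences is then infinite and exceeds
-- each of them.
--
-- (2) b < 2^a.  Alice always plays the sum of all values Bob has played, so no Bob
-- sequence that was ever strictly longer than an infinite Alice sequence exceeds it.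
-- Which sequence she extends is decided by a recursive plan: plan (m+1) G uses her
-- sequences 0..m against a set G of fewer than 2^(m+1) Bob sequences.  Sequence m
-- splits G into the Bob sequences that have overtaken it and the others.  If fewer than
-- 2^m have not, plan m plays against those and sequence m takes enough of its skips to
-- be infinite (so it defeats the overtakers) while still leaving infinitely many skips;
-- otherwise plan m plays against the fewer than 2^m overtakers, sequence m stays finite
-- and all others eventually overtake it.  The split only stabilises in the limit
-- (excluded middle), which is why the guarantees are stated for eventually-followed plans.

open import Defs
open import Data.Nat using (ℕ; zero; suc; _+_; _*_; _≤_; _<_; _^_; _<?_; z≤n; s≤s; _⊔_; _≤′_; ≤′-reflexive; ≤′-step; NonZero)
open import Data.Nat.Properties hiding (_≟_)
open import Algebra.Properties.CommutativeSemigroup +-commutativeSemigroup using (xy∙z≈xz∙y)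
open import Data.Product using (_×_; _,_; ∃-syntax; proj₁; proj₂)
open import Function using (id)
open import Data.Sum using (_⊎_; inj₁; inj₂; [_,_]′)
open import Data.Fin using (Fin; toℕ; fromℕ<; inject≤; _≟_; finToFun; funToFin) renaming (zero to fzero; suc to fsuc)
open import Data.Fin.Properties using (toℕ-injective; toℕ<n; toℕ-fromℕ<; inject≤-injective; finToFun-funToFin; all?)
open import Data.Nat.DivMod using (_%_; _mod_; [m+kn]%n≡m%n; m<n⇒m%n≡m)
open import Data.List using ([]; _∷_; length)
open import Relation.Nullary.Decidable using (_→-dec_; dec-true; dec-false)
open import Data.Bool using (Bool; true; false; _∨_; if_then_else_)
open import Data.Vec using ([]; _∷_; tabulate)
open import Data.Vec.Properties using (lookup∘tabulate; tabulate-cong; []=⇒lookup; lookup⇒[]=)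
open import Data.Fin.Subset using (Subset; inside; outside; _∈_; _∩_; _─_; ∣_∣; ⊤)
open import Data.Fin.Subset.Properties using (_∈?_; ∈⊤; ∣⊤∣≡n; x∈p∩q⁺; x∈p∧x∉q⇒x∈p─q; x∈p⇒∣p-x∣<∣p∣)
open import Data.Bool.Properties using (¬-not; ∨-zeroʳ)
open import Data.Maybe using (Maybe; just; nothing)
open import Data.Maybe.Properties using (just-injective)
open import Data.Empty using (⊥; ⊥-elim)
open import Relation.Nullary using (¬_; Dec; yes; no; does; contradiction)
open import Relation.Binary.PropositionalEquality
open import Level using (0ℓ)
open import Axiom.ExcludedMiddle using (ExcludedMiddle)

Eventually : (ℕ → Set) → Set
Eventually P = ∃[ s ] (∀ t → s ≤ t → P t)

Often : (ℕ → Set) → Set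
Often P = ∀ t → ∃[ t' ] (t ≤ t' × P t')

induction-from : (P : ℕ → Set) {s : ℕ} → P s → (∀ t → s ≤ t → P t → P (suc t)) →
                 ∀ t → s ≤ t → P t
induction-from P {s} base step t s≤t = go (≤⇒≤′ s≤t)
  where
  go : ∀ {t} → s ≤′ t → P t
  go (≤′-reflexive refl) = base
  go (≤′-step {t} s≤′t) = step t (≤′⇒≤ s≤′t) (go s≤′t)

eventually-∧ : {P Q : ℕ → Set} → Eventually P → Eventually Q → Eventually (λ t → P t × Q t)
eventually-∧ (s , p) (s' , q) =
  s ⊔ s' , λ t le → p t (≤-trans (m≤m⊔n s s') le) , q t (≤-trans (m≤n⊔m s s') le)

eventually-∀ : ∀ {n} {P : Fin n → ℕ → Set} → (∀ j → Eventually (P j)) →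
               Eventually (λ t → ∀ j → P j t)
eventually-∀ {zero} ev = 0 , λ _ _ ()
eventually-∀ {suc n} ev with eventually-∧ (ev fzero) (eventually-∀ (λ j → ev (fsuc j)))
... | s , p = s , λ { t le fzero → proj₁ (p t le) ; t le (fsuc j) → proj₂ (p t le) j }

often-∧-eventually : {P Q : ℕ → Set} → Often P → Eventually Q → Often (λ t → P t × Q t)
often-∧-eventually often (s , q) t with often (t ⊔ s)
... | t' , le , p = t' , ≤-trans (m≤m⊔n t s) le , p , q t' (≤-trans (m≤n⊔m t s) le)

often-or-eventually-not : ExcludedMiddle 0ℓ → (P : ℕ → Set) →
                          Often P ⊎ Eventually (λ t → ¬ P t)
often-or-eventually-not em P with em {Eventually (λ t → ¬ P t)}
... | yes never = inj₂ never
... | no ¬never = inj₁ λ t → case t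
  where
  case : ∀ t → ∃[ t' ] (t ≤ t' × P t')
  case t with em {∃[ t' ] (t ≤ t' × P t')}
  ... | yes found = found
  ... | no ¬found = ⊥-elim (¬never (t , λ t' le p → ¬found (t' , le , p)))

monotone-settles : ExcludedMiddle 0ℓ → (f : ℕ → Bool) →
                   (∀ t → f t ≡ true → f (suc t) ≡ true) →
                   ∃[ x ] Eventually (λ t → f t ≡ x)
monotone-settles em f keep with em {∃[ s ] (f s ≡ true)}
... | yes (s , fs) = true , s , induction-from (λ t → f t ≡ true) fs (λ t _ → keep t)
... | no never = false , 0 , λ t _ → ¬-not (λ ft → never (t , ft))

ascending : (f : ℕ → ℕ) → (∀ t → f t ≤ f (suc t)) → ∀ {t u} → t ≤ u → f t ≤ f u
ascending f step {t} t≤u = induction-from (λ u → f t ≤ f u) ≤-refl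
                             (λ u _ le → ≤-trans le (step u)) _ t≤u

grows-slower : (f g : ℕ → ℕ) {s : ℕ} → (∀ t → s ≤ t → f (suc t) + g t ≤ f t + g (suc t)) →
               ∀ u → s ≤ u → f u + g s ≤ f s + g u
grows-slower f g {s} step = induction-from (λ u → f u + g s ≤ f s + g u) ≤-refl next
  where
  next : ∀ t → s ≤ t → f t + g s ≤ f s + g t → f (suc t) + g s ≤ f s + g (suc t)
  next t s≤t ih = +-cancelʳ-≤ (g t) _ _ (begin
    f (suc t) + g s + g t   ≡⟨ xy∙z≈xz∙y (f (suc t)) (g s) (g t) ⟩
    f (suc t) + g t + g s   ≤⟨ +-monoˡ-≤ (g s) (step t s≤t) ⟩
    f t + g (suc t) + g s   ≡⟨ xy∙z≈xz∙y (f t) (g (suc t)) (g s) ⟩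
    f t + g s + g (suc t)   ≤⟨ +-monoˡ-≤ (g (suc t)) ih ⟩
    f s + g t + g (suc t)   ≡⟨ xy∙z≈xz∙y (f s) (g t) (g (suc t)) ⟩
    f s + g (suc t) + g t   ∎)
    where open ≤-Reasoning

often-increasing→eventually-above : (f : ℕ → ℕ) → (∀ t → f t ≤ f (suc t)) →
  Often (λ t → f (suc t) ≡ suc (f t)) → ∀ n → Eventually (λ t → n ≤ f t)
often-increasing→eventually-above f step often zero = 0 , λ _ _ → z≤n
often-increasing→eventually-above f step often (suc n) =
  let (s , above) = often-increasing→eventually-above f step often n
      (t , s≤t , increases) = often s
  in suc t , λ u le → ≤-trans (≤-trans (s≤s (above t s≤t)) (≤-reflexive (sym increases)))
                              (ascending f step le)

hit-self : ∀ {m} (i : Fin m) v → hit i (just (i , v)) ≡ 1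
hit-self i v with i ≟ i
... | yes _ = refl
... | no i≢i = contradiction refl i≢i

hit-other : ∀ {m} {i j : Fin m} v → ¬ i ≡ j → hit i (just (j , v)) ≡ 0
hit-other {i = i} {j} v i≢j with i ≟ j
... | yes i≡j = contradiction i≡j i≢j
... | no _ = refl

hit≤1 : ∀ {m} (i : Fin m) mv → hit i mv ≤ 1
hit≤1 i nothing = z≤n
hit≤1 i (just (j , v)) with i ≟ j
... | yes _ = ≤-refl
... | no _ = z≤n

hit≡1 : ∀ {m} (i : Fin m) mv → hit i mv ≡ 1 → ∃[ v ] (mv ≡ just (i , v))
hit≡1 i (just (j , v)) h with i ≟ j
... | yes refl = v , refl
hit≡1 i (just (j , v)) () | no _

count-mono : ∀ {m} (s : MoveStream m) i {t u} → t ≤ u → count s i t ≤ count s i u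
count-mono s i = ascending (count s i) (λ t → m≤m+n _ _)

count-extend : ∀ {m} (s : MoveStream m) {i t v} → s t ≡ just (i , v) →
               count s i (suc t) ≡ suc (count s i t)
count-extend s {i} {t} {v} e = begin
  count s i t + hit i (s t)         ≡⟨ cong (λ mv → count s i t + hit i mv) e ⟩
  count s i t + hit i (just (i , v)) ≡⟨ cong (count s i t +_) (hit-self i v) ⟩
  count s i t + 1                   ≡⟨ +-comm (count s i t) 1 ⟩
  suc (count s i t)                 ∎
  where open ≡-Reasoning

-- The entry with index k of sequence i was appended in round t, so "sequence i has more
-- than k entries before round u" means exactly t < u.
placed-before : ∀ {m} (s : MoveStream m) {i t k v} → s t ≡ just (i , v) → count s i t ≡ k →
                ∀ {u} → k < count s i u → t < u
placed-before s {i} {t} e c {u} k<cu with t <? u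
... | yes t<u = t<u
... | no t≮u = contradiction (≤-trans (count-mono s i (≮⇒≥ t≮u)) (≤-reflexive c)) (<⇒≱ k<cu)

placed-after : ∀ {m} (s : MoveStream m) {i t k v} → s t ≡ just (i , v) → count s i t ≡ k →
               ∀ {u} → t < u → k < count s i u
placed-after s {i} {t} e refl t<u =
  ≤-trans (≤-reflexive (sym (count-extend s e))) (count-mono s i t<u)

entry-exists : ∀ {m} (s : MoveStream m) i t k → k < count s i t → ∃[ v ] ElemAt s i k v
entry-exists s i zero k ()
entry-exists s i (suc t) k k<c with k <? count s i t
... | yes k<c' = entry-exists s i t k k<c'
... | no k≮c' = v , t , e , c≡k
  where
  c≤k : count s i t ≤ k
  c≤k = ≮⇒≥ k≮c'
  hit≡1' : hit i (s t) ≡ 1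
  hit≡1' = ≤-antisym (hit≤1 i (s t)) (+-cancelˡ-≤ (count s i t) 1 (hit i (s t))
             (≤-trans (≤-reflexive (+-comm (count s i t) 1)) (≤-trans (s≤s c≤k) k<c)))
  v = proj₁ (hit≡1 i (s t) hit≡1')
  e = proj₂ (hit≡1 i (s t) hit≡1')
  c≡k : count s i t ≡ k
  c≡k = ≤-antisym c≤k (≤-pred (≤-trans k<c (≤-reflexive (count-extend s e))))

unbounded→infinite : ∀ {m} (s : MoveStream m) i → (∀ n → ∃[ t ] (n ≤ count s i t)) → Infinite s i
unbounded→infinite s i unb k = entry-exists s i (proj₁ (unb (suc k))) k (proj₂ (unb (suc k)))

infinite→unbounded : ∀ {m} (s : MoveStream m) i → Infinite s i → ∀ n → ∃[ t ] (n ≤ count s i t)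
infinite→unbounded s i inf n with inf n
... | _ , t , _ , c = t , ≤-reflexive (sym c)

often-extended→infinite : ∀ {m} (s : MoveStream m) i → Often (λ t → hit i (s t) ≡ 1) → Infinite s i
often-extended→infinite s i often = unbounded→infinite s i λ n →
  let (t , above) = often-increasing→eventually-above (count s i) (λ t → m≤m+n _ _) steps n
  in t , above t ≤-refl
  where
  steps : Often (λ t → count s i (suc t) ≡ suc (count s i t))
  steps t = let (t′ , le , h) = often t in t′ , le , trans (cong (count s i t′ +_) h) (+-comm _ 1)

eventually-frozen : ∀ {m} (s : MoveStream m) i → Eventually (λ t → hit i (s t) ≡ 0) →
                    ∃[ c ] Eventually (λ t → count s i t ≡ c)
eventually-frozen s i (t₀ , never) =
  count s i t₀ , t₀ , induction-from (λ t → count s i t ≡ count s i t₀) refl step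
  where
  step : ∀ t → t₀ ≤ t → count s i t ≡ count s i t₀ → count s i (suc t) ≡ count s i t₀
  step t le ih = trans (cong (count s i t +_) (never t le)) (trans (+-identityʳ _) ih)

value : ∀ {m} → Move m → ℕ
value nothing = 0
value (just (_ , v)) = v

total : ∀ {m} → MoveStream m → ℕ → ℕ
total s zero = 0
total s (suc t) = total s t + value (s t)

total-mono : ∀ {m} (s : MoveStream m) {t u} → t ≤ u → total s t ≤ total s u
total-mono s = ascending (total s) (λ t → m≤m+n _ _)

value≤total : ∀ {m} (s : MoveStream m) {t i v} → s t ≡ just (i , v) → v ≤ total s (suc t)
value≤total s {t} e = ≤-trans (m≤n+m _ (total s t)) (≤-reflexive (cong (λ mv → total s t + value mv) (sym e)))

-- If every value of s' is at least the running total of s, then a sequence j of s that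
-- was once strictly longer than an infinite sequence i of s' does not exceed it: at the
-- index where i lagged, j's entry is older than i's and hence not larger.
behind→not-exceeded : ∀ {m n} (s : MoveStream m) (s' : MoveStream n) {j i t} →
  (∀ r {i' w} → s' r ≡ just (i' , w) → total s r ≤ w) →
  Infinite s j → Infinite s' i → count s' i t < count s j t → ¬ Exceeds s j s' i
behind→not-exceeded s s' {j} {i} {t} dominates inf-j inf-i lag exceeds
  with inf-j (count s' i t) | inf-i (count s' i t)
... | v , tj , ej , cj | w , ti , ei , ci =
  <⇒≱ (exceeds (count s' i t) v w (tj , ej , cj) (ti , ei , ci)) (begin
    v                 ≤⟨ value≤total s ej ⟩
    total s (suc tj)  ≤⟨ total-mono s (≤-trans (placed-before s ej cj lag) t≤ti) ⟩
    total s ti        ≤⟨ dominates ti ei ⟩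
    w                 ∎)
  where
  open ≤-Reasoning
  t≤ti : t ≤ ti
  t≤ti = ≮⇒≥ (λ ti<t → <-irrefl refl (placed-after s' ei ci ti<t))

ahead→exceeds : ∀ {m n} (s : MoveStream m) (s' : MoveStream n) {j i} →
  (∀ r {j' v} → s r ≡ just (j' , v) → total s' (suc r) < v) →
  (∀ r {v} → s r ≡ just (j , v) → count s j r < count s' i (suc r)) →
  Exceeds s j s' i
ahead→exceeds s s' {j} {i} dominates waits k v w (tj , ej , cj) (ti , ei , ci) = begin-strict
  w                  ≤⟨ value≤total s' ei ⟩
  total s' (suc ti)  ≤⟨ total-mono s' (placed-before s' ei ci (subst (_< count s' i (suc tj)) cj (waits tj ej))) ⟩
  total s' (suc tj)  <⟨ dominates tj ej ⟩
  v                  ∎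
  where open ≤-Reasoning

-- Lengths and sums of values as recorded in a history (most recent round first); these
-- are what the strategies can see.
lengthA : ∀ {a b} → History a b → Fin a → ℕ
lengthA [] i = 0
lengthA ((x , _) ∷ h) i = lengthA h i + hit i x

lengthB : ∀ {a b} → History a b → Fin b → ℕ
lengthB [] j = 0
lengthB ((_ , y) ∷ h) j = lengthB h j + hit j y

sumA : ∀ {a b} → History a b → ℕ
sumA [] = 0
sumA ((x , _) ∷ h) = sumA h + value x

sumB : ∀ {a b} → History a b → ℕ
sumB [] = 0
sumB ((_ , y) ∷ h) = sumB h + value y

module Observed {a b : ℕ} (σA : AliceStrategy a b) (σB : BobStrategy a b) where
  open Play σA σB

  length-hist : ∀ t → length (hist t) ≡ t
  length-hist zero = refl
  length-hist (suc t) = cong suc (length-hist t)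

  lengthA-hist : ∀ t i → lengthA (hist t) i ≡ count aliceMoves i t
  lengthA-hist zero i = refl
  lengthA-hist (suc t) i = cong (_+ hit i (aliceMoves t)) (lengthA-hist t i)

  lengthB-hist : ∀ t j → lengthB (hist t) j ≡ count bobMoves j t
  lengthB-hist zero j = refl
  lengthB-hist (suc t) j = cong (_+ hit j (bobMoves t)) (lengthB-hist t j)

  sumA-hist : ∀ t → sumA (hist t) ≡ total aliceMoves t
  sumA-hist zero = refl
  sumA-hist (suc t) = cong (_+ value (aliceMoves t)) (sumA-hist t)

  sumB-hist : ∀ t → sumB (hist t) ≡ total bobMoves t
  sumB-hist zero = refl
  sumB-hist (suc t) = cong (_+ value (bobMoves t)) (sumB-hist t)

when : ∀ {m} {P : Set} → Dec P → Move m → Move m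
when (yes _) x = x
when (no _) x = nothing

when-just : ∀ {m} {P : Set} (d : Dec P) {x : Move m} {y : Fin m × ℕ} →
            when d x ≡ just y → P × x ≡ just y
when-just (yes p) e = p , e
when-just (no _) ()

when-yes : ∀ {m} {P : Set} (d : Dec P) {x : Move m} → P → when d x ≡ x
when-yes (yes _) _ = refl
when-yes (no ¬p) p = contradiction p ¬p

indicator : ∀ {P : Set} → Dec P → Fin 2
indicator (yes _) = fsuc fzero
indicator (no _) = fzero

indicator-sound : ∀ {P : Set} (d : Dec P) → indicator d ≡ fsuc fzero → P
indicator-sound (yes p) _ = p
indicator-sound (no _) ()

indicator-complete : ∀ {P : Set} (d : Dec P) → P → indicator d ≡ fsuc fzero
indicator-complete (yes _) _ = refl
indicator-complete (no ¬p) p = contradiction p ¬p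

mod-periodic : ∀ K .{{_ : NonZero K}} (c : Fin K) n → (toℕ c + n * K) mod K ≡ c
mod-periodic K c n = toℕ-injective (begin
  toℕ ((toℕ c + n * K) mod K) ≡⟨ toℕ-fromℕ< _ ⟩
  (toℕ c + n * K) % K         ≡⟨ [m+kn]%n≡m%n (toℕ c) n K ⟩
  toℕ c % K                   ≡⟨ m<n⇒m%n≡m (toℕ<n c) ⟩
  toℕ c                       ∎)
  where open ≡-Reasoning

-- Bob's strategy for 2^a ≤ b.  Codes c : Fin (2^a) label Bob's first 2^a sequences and
-- encode the patterns finToFun c : Fin a → Fin 2; in round r Bob serves code r mod 2^a.
module BobStrategy {a b : ℕ} (2^a≤b : 2 ^ a ≤ b) where
  instance
    2^a≢0 : NonZero (2 ^ a)
    2^a≢0 = m^n≢0 2 a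

  labelled : Fin (2 ^ a) → Fin b
  labelled c = inject≤ c 2^a≤b

  Marked : Fin (2 ^ a) → Fin a → Set
  Marked c i = finToFun c i ≡ fsuc fzero

  served : ℕ → Fin (2 ^ a)
  served r = r mod 2 ^ a

  MayGrow : History a b → Move a → Fin (2 ^ a) → Set
  MayGrow h x c = ∀ i → Marked c i → lengthB h (labelled c) < lengthA h i + hit i x

  mayGrow? : ∀ h x c → Dec (MayGrow h x c)
  mayGrow? h x c = all? λ i →
    (finToFun c i ≟ fsuc fzero) →-dec (lengthB h (labelled c) <? lengthA h i + hit i x)

  σB : BobStrategy a b
  σB h x = when (mayGrow? h x c) (just (labelled c , suc (sumA h + value x)))
    where c = served (length h)

module BobWins {a b : ℕ} (2^a≤b : 2 ^ a ≤ b) (em : ExcludedMiddle 0ℓ) (σA : AliceStrategy a b) where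
  open BobStrategy {a} {b} 2^a≤b
  open Play σA σB
  open Observed σA σB

  MayGrowAt : ℕ → Fin (2 ^ a) → Set
  MayGrowAt r c = ∀ i → Marked c i → count bobMoves (labelled c) r < count aliceMoves i (suc r)

  may-grow-at : ∀ r c → MayGrow (hist r) (aliceMoves r) c → MayGrowAt r c
  may-grow-at r c g i marked = subst₂ _<_ (lengthB-hist r (labelled c))
    (cong (_+ hit i (aliceMoves r)) (lengthA-hist r i)) (g i marked)

  may-grow-hist : ∀ r c → MayGrowAt r c → MayGrow (hist r) (aliceMoves r) c
  may-grow-hist r c g i marked = subst₂ _<_ (sym (lengthB-hist r (labelled c)))
    (cong (_+ hit i (aliceMoves r)) (sym (lengthA-hist r i))) (g i marked)

  bob-move : ∀ r → bobMoves r ≡ when (mayGrow? (hist r) (aliceMoves r) (served r))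
                                  (just (labelled (served r) , suc (total aliceMoves (suc r))))
  bob-move r = cong₂ (λ n σ → when (mayGrow? (hist r) (aliceMoves r) (served n))
                                 (just (labelled (served n) , suc (σ + value (aliceMoves r)))))
                     (length-hist r) (sumA-hist r)

  bob-extends : ∀ r {j v} → bobMoves r ≡ just (j , v) →
                MayGrowAt r (served r) × labelled (served r) ≡ j × v ≡ suc (total aliceMoves (suc r))
  bob-extends r e = may-grow-at r (served r) (proj₁ extension) , cong proj₁ move≡ , sym (cong proj₂ move≡)
    where
    extension = when-just (mayGrow? (hist r) (aliceMoves r) (served r)) (trans (sym (bob-move r)) e)
    move≡ = just-injective (proj₂ extension)

  infinitePattern : Fin a → Fin 2
  infinitePattern i = indicator (em {Infinite aliceMoves i})

  championCode : Fin (2 ^ a)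
  championCode = funToFin infinitePattern

  champion : Fin b
  champion = labelled championCode

  marked→infinite : ∀ {i} → Marked championCode i → Infinite aliceMoves i
  marked→infinite {i} marked =
    indicator-sound em (trans (sym (finToFun-funToFin infinitePattern i)) marked)

  infinite→marked : ∀ {i} → Infinite aliceMoves i → Marked championCode i
  infinite→marked {i} inf =
    trans (finToFun-funToFin infinitePattern i) (indicator-complete em inf)

  served-again : ∀ c t → ∃[ r ] (t ≤ r × served r ≡ c)
  served-again c t = toℕ c + t * 2 ^ a , ≤-trans (m≤m*n t (2 ^ a)) (m≤n+m _ (toℕ c)) ,
                     mod-periodic (2 ^ a) c t

  marked-long : ∀ n → Eventually (λ t → ∀ i → Marked championCode i → n < count aliceMoves i t)
  marked-long n = eventually-∀ long
    where
    long : ∀ i → Eventually (λ t → Marked championCode i → n < count aliceMoves i t)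
    long i with finToFun championCode i ≟ fsuc fzero
    ... | no ¬marked = 0 , λ _ _ marked → contradiction marked ¬marked
    ... | yes marked with infinite→unbounded aliceMoves i (marked→infinite marked) (suc n)
    ...   | t , n<c = t , λ u t≤u _ → ≤-trans n<c (count-mono aliceMoves i t≤u)

  champion-moves : ∀ r → served r ≡ championCode → MayGrowAt r championCode →
                   bobMoves r ≡ just (champion , suc (total aliceMoves (suc r)))
  champion-moves r served-r may = begin
    bobMoves r
      ≡⟨ bob-move r ⟩
    when (mayGrow? (hist r) (aliceMoves r) (served r)) (just (labelled (served r) , v))
      ≡⟨ cong (λ c → when (mayGrow? (hist r) (aliceMoves r) c) (just (labelled c , v))) served-r ⟩
    when (mayGrow? (hist r) (aliceMoves r) championCode) (just (champion , v))
      ≡⟨ when-yes (mayGrow? (hist r) (aliceMoves r) championCode) (may-grow-hist r championCode may) ⟩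
    just (champion , v)
      ∎
    where
    open ≡-Reasoning
    v = suc (total aliceMoves (suc r))

  -- The champion grows without bound: in a late round serving it, it is either already
  -- longer than n, or of length n and hence shorter than every infinite Alice sequence.
  champion-grows : ∀ n → ∃[ t ] (n ≤ count bobMoves champion t)
  champion-grows zero = 0 , z≤n
  champion-grows (suc n) = grow (champion-grows n) (marked-long n)
    where
    grow : ∃[ t ] (n ≤ count bobMoves champion t) →
           Eventually (λ t → ∀ i → Marked championCode i → n < count aliceMoves i t) →
           ∃[ t ] (suc n ≤ count bobMoves champion t)
    grow (t₀ , n≤c) (t₁ , long) =
      [ (λ n<c → r , n<c) , (λ n≡c → suc r , grown n≡c) ]′ (m≤n⇒m<n∨m≡n n≤cr)
      where
      r = proj₁ (served-again championCode (t₀ ⊔ t₁))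
      late = proj₁ (proj₂ (served-again championCode (t₀ ⊔ t₁)))
      served-r = proj₂ (proj₂ (served-again championCode (t₀ ⊔ t₁)))
      n≤cr : n ≤ count bobMoves champion r
      n≤cr = ≤-trans n≤c (count-mono bobMoves champion (≤-trans (m≤m⊔n t₀ t₁) late))
      may : n ≡ count bobMoves champion r → MayGrowAt r championCode
      may n≡c i marked = begin-strict
        count bobMoves champion r     ≡⟨ n≡c ⟨
        n                             <⟨ long r (≤-trans (m≤n⊔m t₀ t₁) late) i marked ⟩
        count aliceMoves i r          ≤⟨ count-mono aliceMoves i (n≤1+n r) ⟩
        count aliceMoves i (suc r)    ∎
        where open ≤-Reasoning
      grown : n ≡ count bobMoves champion r → suc n ≤ count bobMoves champion (suc r)
      grown n≡c = ≤-reflexive (sym (trans (count-extend bobMoves (champion-moves r served-r (may n≡c)))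
                                          (cong suc (sym n≡c))))

  champion-waits : ∀ i → Infinite aliceMoves i →
                   ∀ r {v} → bobMoves r ≡ just (champion , v) →
                   count bobMoves champion r < count aliceMoves i (suc r)
  champion-waits i inf r e = subst (λ c → MayGrowAt r c) served-r may i (infinite→marked inf)
    where
    may = proj₁ (bob-extends r e)
    served-r : served r ≡ championCode
    served-r = inject≤-injective 2^a≤b 2^a≤b (served r) championCode (proj₁ (proj₂ (bob-extends r e)))

  wins : BobWinsPlay σA σB
  wins = champion , unbounded→infinite bobMoves champion champion-grows , λ i inf →
    ahead→exceeds bobMoves aliceMoves
      (λ r e → ≤-reflexive (sym (proj₂ (proj₂ (bob-extends r e)))))
      (champion-waits i inf)

bob-wins : ∀ {a b} → ExcludedMiddle 0ℓ → 2 ^ a ≤ b → BobHasWinningStrategy a b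
bob-wins {a} {b} em 2^a≤b = BobStrategy.σB {a} {b} 2^a≤b , λ σA → BobWins.wins {a} {b} 2^a≤b em σA

∣p∩q∣+∣p─q∣≡∣p∣ : ∀ {n} (p q : Subset n) → ∣ p ∩ q ∣ + ∣ p ─ q ∣ ≡ ∣ p ∣
∣p∩q∣+∣p─q∣≡∣p∣ [] [] = refl
∣p∩q∣+∣p─q∣≡∣p∣ (inside ∷ p) (inside ∷ q) = cong suc (∣p∩q∣+∣p─q∣≡∣p∣ p q)
∣p∩q∣+∣p─q∣≡∣p∣ (inside ∷ p) (outside ∷ q) = trans (+-suc _ _) (cong suc (∣p∩q∣+∣p─q∣≡∣p∣ p q))
∣p∩q∣+∣p─q∣≡∣p∣ (outside ∷ p) (inside ∷ q) = ∣p∩q∣+∣p─q∣≡∣p∣ p q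
∣p∩q∣+∣p─q∣≡∣p∣ (outside ∷ p) (outside ∷ q) = ∣p∩q∣+∣p─q∣≡∣p∣ p q

∈-tabulate : ∀ {n} (f : Fin n → Bool) {j} → f j ≡ true → j ∈ tabulate f
∈-tabulate f {j} fj = lookup⇒[]= j (tabulate f) (trans (lookup∘tabulate f j) fj)

∈-tabulate⁻ : ∀ {n} (f : Fin n → Bool) {j} → j ∈ tabulate f → f j ≡ true
∈-tabulate⁻ f {j} j∈ = trans (sym (lookup∘tabulate f j)) ([]=⇒lookup j∈)

skipped : ∀ {m} → Maybe (Fin m) → ℕ
skipped nothing = 1
skipped (just _) = 0

chosen : ∀ {m} → Fin m → Maybe (Fin m) → ℕ
chosen i nothing = 0
chosen i (just k) = hit i (just (k , 0))

chosen-self : ∀ {m} (i : Fin m) → chosen i (just i) ≡ 1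
chosen-self i = hit-self i 0

chosen-miss : ∀ {m} (i : Fin m) q → ¬ q ≡ just i → chosen i q ≡ 0
chosen-miss i nothing _ = refl
chosen-miss i (just k) k≢i = hit-other 0 (λ i≡k → k≢i (cong just (sym i≡k)))

toMove : ∀ {m} → Maybe (Fin m) → ℕ → Move m
toMove nothing v = nothing
toMove (just i) v = just (i , v)

hit-toMove : ∀ {m} (i : Fin m) q v → hit i (toMove q v) ≡ chosen i q
hit-toMove i nothing v = refl
hit-toMove i (just k) v with i ≟ k
... | yes _ = refl
... | no _ = refl

toMove-value : ∀ {m} q v {i : Fin m} {w} → toMove q v ≡ just (i , w) → v ≡ w
toMove-value (just k) v refl = refl

∨-true⁻ : ∀ x y → x ∨ y ≡ true → x ≡ true ⊎ y ≡ true
∨-true⁻ true _ _ = inj₁ refl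
∨-true⁻ false _ e = inj₂ e

does-true⁻ : ∀ {P : Set} (d : Dec P) → does d ≡ true → P
does-true⁻ (yes p) _ = p
does-true⁻ (no _) ()

fillSkip : ∀ {m} → Maybe (Fin m) → Bool → Fin m → Maybe (Fin m)
fillSkip (just k) _ _ = just k
fillSkip nothing true i = just i
fillSkip nothing false _ = nothing

chosen-fillSkip : ∀ {m} (k i : Fin m) q allowed → ¬ k ≡ i → chosen k (fillSkip q allowed i) ≡ chosen k q
chosen-fillSkip k i (just _) allowed _ = refl
chosen-fillSkip k i nothing true k≢i = hit-other 0 k≢i
chosen-fillSkip k i nothing false _ = refl

fillSkip-range : ∀ {m} (P : Fin m → Set) q allowed {i k} → (∀ {k'} → q ≡ just k' → P k') → P i →
                 fillSkip q allowed i ≡ just k → P k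
fillSkip-range P (just k') allowed lower-ok i-ok e = lower-ok (cong just (just-injective e))
fillSkip-range P nothing true lower-ok i-ok refl = i-ok
fillSkip-range P nothing false lower-ok i-ok ()

fillSkip-allowed : ∀ {m} {P : Set} (d : Dec P) (i : Fin m) → P → fillSkip nothing (does d) i ≡ just i
fillSkip-allowed (yes _) i _ = refl
fillSkip-allowed (no ¬p) i p = contradiction p ¬p

fillSkip-filled : ∀ {m} {P : Set} (d : Dec P) (i : Fin m) → ¬ fillSkip nothing (does d) i ≡ nothing → P
fillSkip-filled (yes p) i _ = p
fillSkip-filled (no _) i not-skipped = contradiction refl not-skipped

module AliceStrategy {a b : ℕ} where
  overtaken : History a b → Fin b → Fin a → Bool
  overtaken [] j i = false
  overtaken (x ∷ h) j i = overtaken h j i ∨ does (lengthA (x ∷ h) i <? lengthB (x ∷ h) j)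

  overtakers : History a b → Fin a → Subset b
  overtakers h i = tabulate (λ j → overtaken h j i)

  skips : (History a b → Maybe (Fin a)) → History a b → ℕ
  skips q [] = 0
  skips q (x ∷ h) = skips q h + skipped (q h)

  -- The Bob sequences of G still behind i ("alive") are
  -- handed to `lower` if there are fewer than 2^m of them, and i then takes every other
  -- skip of `lower`; otherwise `lower` is played against those that have overtaken i.
  raise : ℕ → (Subset b → History a b → Maybe (Fin a)) → Fin a → Subset b → History a b → Maybe (Fin a)
  raise m lower i G h =
    if does (∣ G ─ overtakers h i ∣ <? 2 ^ m)
    then fillSkip (lower (G ─ overtakers h i) h)
                  (does (2 * lengthA h i <? skips (λ h' → lower (G ─ overtakers h' i) h') h)) i
    else lower (G ∩ overtakers h i) h

  plan : (m : ℕ) → m ≤ a → Subset b → History a b → Maybe (Fin a)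
  plan zero _ G h = nothing
  plan (suc m) m<a = raise m (plan m (<⇒≤ m<a)) (fromℕ< m<a)

  σA : AliceStrategy a b
  σA h = toMove (plan a ≤-refl ⊤ h) (sumB h)

  raise-range : ∀ m lower i → toℕ i ≡ m → (∀ G h {k} → lower G h ≡ just k → toℕ k < m) →
                ∀ G h {k} → raise m lower i G h ≡ just k → toℕ k < suc m
  raise-range m lower i i≡m lower-range G h e with does (∣ G ─ overtakers h i ∣ <? 2 ^ m)
  ... | false = m<n⇒m<1+n (lower-range _ h e)
  ... | true = fillSkip-range (λ k → toℕ k < suc m) (lower (G ─ overtakers h i) h) _
                 (λ e' → m<n⇒m<1+n (lower-range _ h e')) (≤-reflexive (cong suc i≡m)) e

  plan-range : ∀ m m≤a G h {k} → plan m m≤a G h ≡ just k → toℕ k < m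
  plan-range zero _ G h ()
  plan-range (suc m) m<a = raise-range m (plan m (<⇒≤ m<a)) (fromℕ< m<a) (toℕ-fromℕ< m<a) (plan-range m (<⇒≤ m<a))

-- Arithmetic core of the skipping argument: C cannot have grown by at most as much as L
-- since an earlier round (c₁, l₁), satisfy 2·L < C now, and have at least doubled.
slow-growth-absurd : ∀ {c₁ l₁ c₃ l₃} → c₃ + l₁ ≤ c₁ + l₃ → 2 * l₃ < c₃ → 2 * c₁ ≤ c₃ → ⊥
slow-growth-absurd {c₁} {l₁} {c₃} {l₃} slow lt doubled = <-irrefl refl (begin-strict
  2 * c₃           ≤⟨ *-monoʳ-≤ 2 (≤-trans (m≤m+n c₃ l₁) slow) ⟩
  2 * (c₁ + l₃)    ≡⟨ *-distribˡ-+ 2 c₁ l₃ ⟩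
  2 * c₁ + 2 * l₃  <⟨ +-monoʳ-< (2 * c₁) lt ⟩
  2 * c₁ + c₃      ≤⟨ +-monoˡ-≤ c₃ doubled ⟩
  c₃ + c₃          ≡⟨ cong (c₃ +_) (+-identityʳ c₃) ⟨
  2 * c₃           ∎)
  where open ≤-Reasoning

module AliceWins (em : ExcludedMiddle 0ℓ) {a b : ℕ} (σB : BobStrategy a b) where
  open AliceStrategy {a} {b}
  open Play σA σB
  open Observed σA σB

  Overtakes : Fin b → Fin a → Set
  Overtakes j i = ∃[ t ] (count aliceMoves i t < count bobMoves j t)

  overtaken-intro : ∀ t {j i} → count aliceMoves i t < count bobMoves j t → overtaken (hist t) j i ≡ true
  overtaken-intro zero ()
  overtaken-intro (suc t) {j} {i} lag =
    trans (cong (overtaken (hist t) j i ∨_) (dec-true (lengthA (hist (suc t)) i <? lengthB (hist (suc t)) j) lag′))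
          (∨-zeroʳ _)
    where
    lag′ = subst₂ _<_ (sym (lengthA-hist (suc t) i)) (sym (lengthB-hist (suc t) j)) lag

  overtaken-elim : ∀ t {j i} → overtaken (hist t) j i ≡ true → Overtakes j i
  overtaken-elim zero ()
  overtaken-elim (suc t) {j} {i} e = [ overtaken-elim t , now ]′ (∨-true⁻ _ _ e)
    where
    now : does (lengthA (hist (suc t)) i <? lengthB (hist (suc t)) j) ≡ true → Overtakes j i
    now d = suc t , subst₂ _<_ (lengthA-hist (suc t) i) (lengthB-hist (suc t) j)
                      (does-true⁻ (lengthA (hist (suc t)) i <? lengthB (hist (suc t)) j) d)

  overtaken-persists : ∀ t {j i} → overtaken (hist t) j i ≡ true → overtaken (hist (suc t)) j i ≡ true
  overtaken-persists t {j} {i} e =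
    cong (_∨ does (lengthA (hist (suc t)) i <? lengthB (hist (suc t)) j)) e

  overtakers-settle : ∀ i → ∃[ O ] Eventually (λ t → overtakers (hist t) i ≡ O)
  overtakers-settle i = tabulate limit , s , λ t le → tabulate-cong (settled t le)
    where
    settles : ∀ j → ∃[ x ] Eventually (λ t → overtaken (hist t) j i ≡ x)
    settles j = monotone-settles em (λ t → overtaken (hist t) j i) (λ t → overtaken-persists t)
    limit : Fin b → Bool
    limit j = proj₁ (settles j)
    s = proj₁ (eventually-∀ (λ j → proj₂ (settles j)))
    settled = proj₂ (eventually-∀ (λ j → proj₂ (settles j)))

  eventually-overtaken : ∀ {i j c} → Eventually (λ t → count aliceMoves i t ≡ c) → Infinite bobMoves j →
                         Eventually (λ t → j ∈ overtakers (hist t) i)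
  eventually-overtaken {i} {j} {c} (s , frozen) inf = t₀ , λ t le →
    ∈-tabulate (λ j → overtaken (hist t) j i)
      (induction-from (λ t → overtaken (hist t) j i ≡ true) (overtaken-intro t₀ lag)
                      (λ t _ → overtaken-persists t) t le)
    where
    tb = proj₁ (infinite→unbounded bobMoves j inf (suc c))
    t₀ = s ⊔ tb
    lag : count aliceMoves i t₀ < count bobMoves j t₀
    lag = begin-strict
      count aliceMoves i t₀  ≡⟨ frozen t₀ (m≤m⊔n s tb) ⟩
      c                      <⟨ proj₂ (infinite→unbounded bobMoves j inf (suc c)) ⟩
      count bobMoves j tb    ≤⟨ count-mono bobMoves j (m≤n⊔m s tb) ⟩
      count bobMoves j t₀    ∎
      where open ≤-Reasoning

  FollowsAt : ℕ → (History a b → Maybe (Fin a)) → ℕ → Set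
  FollowsAt m q t = ∀ k → toℕ k < m → hit k (aliceMoves t) ≡ chosen k (q (hist t))

  record Guarantee (m : ℕ) (q : History a b → Maybe (Fin a)) (G : Subset b) : Set where
    field
      skips-often : Often (λ t → q (hist t) ≡ nothing)
      defeats : ∀ {j} → j ∈ G → Infinite bobMoves j →
                ∃[ i ] (toℕ i < m × Infinite aliceMoves i × Overtakes j i)

  Correct : ℕ → (Subset b → History a b → Maybe (Fin a)) → Set
  Correct m lower = ∀ G → ∣ G ∣ < 2 ^ m → Eventually (FollowsAt m (lower G)) → Guarantee m (lower G) G

  empty-correct : Correct 0 (λ _ _ → nothing)
  empty-correct G small _ = record
    { skips-often = λ t → t , ≤-refl , refl
    ; defeats = λ j∈G _ → contradiction (≤-<-trans z≤n (x∈p⇒∣p-x∣<∣p∣ j∈G)) (<⇒≱ small)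
    }

  module Step (m : ℕ) (lower : Subset b → History a b → Maybe (Fin a)) (i : Fin a) (i≡m : toℕ i ≡ m)
               (lower-range : ∀ G h {k} → lower G h ≡ just k → toℕ k < m)
               (lower-correct : Correct m lower)
               (G : Subset b) (small : ∣ G ∣ < 2 ^ suc m)
               (follows : Eventually (FollowsAt (suc m) (raise m lower i G))) where

    O A D : Subset b
    O = proj₁ (overtakers-settle i)
    A = G ─ O
    D = G ∩ O

    choice : ℕ → Maybe (Fin a)
    choice t = raise m lower i G (hist t)

    L C : ℕ → ℕ
    L t = count aliceMoves i t
    C t = skips (λ h → lower (G ─ overtakers h i) h) (hist t)

    Settled : ℕ → Set
    Settled t = FollowsAt (suc m) (raise m lower i G) t × overtakers (hist t) i ≡ O

    settled : Eventually Settled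
    settled = eventually-∧ follows (proj₂ (overtakers-settle i))

    choice-settled : ∀ {t} → Settled t → choice t ≡
      (if does (∣ A ∣ <? 2 ^ m) then fillSkip (lower A (hist t)) (does (2 * L t <? C t)) i else lower D (hist t))
    choice-settled {t} (_ , O-now) = cong₂
      (λ O′ ℓ → if does (∣ G ─ O′ ∣ <? 2 ^ m) then fillSkip (lower (G ─ O′) (hist t)) (does (2 * ℓ <? C t)) i
                else lower (G ∩ O′) (hist t))
      O-now (lengthA-hist t i)

    i-follows : ∀ {t} → Settled t → hit i (aliceMoves t) ≡ chosen i (choice t)
    i-follows (follows-t , _) = follows-t i (≤-reflexive (cong suc i≡m))

    below≢i : ∀ {k} → toℕ k < m → ¬ k ≡ i
    below≢i k<m refl = <-irrefl i≡m k<m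

    widen : ∀ {R : Fin a → Set} → ∃[ k ] (toℕ k < m × R k) → ∃[ k ] (toℕ k < suc m × R k)
    widen (k , k<m , r) = k , m<n⇒m<1+n k<m , r

    -- Mode 1: at least 2^m Bob sequences never overtake i.  Then fewer than 2^m have, the
    -- lower plan is played against those, i stops growing, and so the others are finite.
    module Crowded (crowded : ¬ ∣ A ∣ < 2 ^ m) where
      choice≡ : ∀ {t} → Settled t → choice t ≡ lower D (hist t)
      choice≡ {t} st = trans (choice-settled st)
        (cong (λ d → if d then fillSkip (lower A (hist t)) (does (2 * L t <? C t)) i else lower D (hist t))
              (dec-false (∣ A ∣ <? 2 ^ m) crowded))

      small-D : ∣ D ∣ < 2 ^ m
      small-D = +-cancelʳ-< (∣ A ∣) (∣ D ∣) (2 ^ m) (begin-strict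
        ∣ D ∣ + ∣ A ∣    ≡⟨ ∣p∩q∣+∣p─q∣≡∣p∣ G O ⟩
        ∣ G ∣            <⟨ small ⟩
        2 ^ m + (2 ^ m + 0) ≡⟨ cong (2 ^ m +_) (+-identityʳ (2 ^ m)) ⟩
        2 ^ m + 2 ^ m    ≤⟨ +-monoʳ-≤ (2 ^ m) (≮⇒≥ crowded) ⟩
        2 ^ m + ∣ A ∣    ∎)
        where open ≤-Reasoning

      sub : Guarantee m (lower D) D
      sub = lower-correct D small-D (proj₁ settled , λ t le k k<m →
        trans (proj₁ (proj₂ settled t le) k (m<n⇒m<1+n k<m)) (cong (chosen k) (choice≡ (proj₂ settled t le))))

      i-frozen : ∃[ c ] Eventually (λ t → count aliceMoves i t ≡ c)
      i-frozen = eventually-frozen aliceMoves i (proj₁ settled , λ t le →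
        trans (i-follows (proj₂ settled t le))
          (trans (cong (chosen i) (choice≡ (proj₂ settled t le)))
                 (chosen-miss i _ (λ e → <-irrefl i≡m (lower-range D (hist t) e)))))

      guarantee : Guarantee (suc m) (raise m lower i G) G
      guarantee = record
        { skips-often = λ t →
            let (t′ , le , skip , st) = often-∧-eventually (Guarantee.skips-often sub) settled t
            in t′ , le , trans (choice≡ st) skip
        ; defeats = defeats
        }
        where
        defeats : ∀ {j} → j ∈ G → Infinite bobMoves j → ∃[ k ] (toℕ k < suc m × Infinite aliceMoves k × Overtakes j k)
        defeats {j} j∈G inf with j ∈? O
        ... | yes j∈O = widen (Guarantee.defeats sub (x∈p∩q⁺ (j∈G , j∈O)) inf)
        ... | no j∉O =
          let (s , overtaken-settled) = eventually-∧ (eventually-overtaken (proj₂ i-frozen) inf) settled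
              (j∈now , _ , O-now) = overtaken-settled s ≤-refl
          in contradiction (subst (j ∈_) O-now j∈now) j∉O

    -- Mode 2: fewer than 2^m Bob sequences never overtake i.  The lower plan is played
    -- against those, and i is extended in a skip of the lower plan iff 2·L < C.  Then i
    -- is extended infinitely often (so it is infinite and defeats all overtakers) while
    -- the level still skips infinitely often.
    module Sparse (sparse : ∣ A ∣ < 2 ^ m) where
      choice≡ : ∀ {t} → Settled t → choice t ≡ fillSkip (lower A (hist t)) (does (2 * L t <? C t)) i
      choice≡ {t} st = trans (choice-settled st)
        (cong (λ d → if d then fillSkip (lower A (hist t)) (does (2 * L t <? C t)) i else lower D (hist t))
              (dec-true (∣ A ∣ <? 2 ^ m) sparse))

      sub : Guarantee m (lower A) A
      sub = lower-correct A sparse (proj₁ settled , λ t le k k<m →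
        trans (proj₁ (proj₂ settled t le) k (m<n⇒m<1+n k<m))
          (trans (cong (chosen k) (choice≡ (proj₂ settled t le)))
                 (chosen-fillSkip k i (lower A (hist t)) _ (below≢i k<m))))

      skip-filled : ∀ {t} → Settled t → lower A (hist t) ≡ nothing → 2 * L t < C t → choice t ≡ just i
      skip-filled {t} st skip lt = trans (choice≡ st)
        (trans (cong (λ q → fillSkip q (does (2 * L t <? C t)) i) skip) (fillSkip-allowed (2 * L t <? C t) i lt))

      skip-filled⁻ : ∀ {t} → Settled t → lower A (hist t) ≡ nothing → ¬ choice t ≡ nothing → 2 * L t < C t
      skip-filled⁻ {t} st skip not-skipped = fillSkip-filled (2 * L t <? C t) i
        (λ e → not-skipped (trans (choice≡ st) (trans (cong (λ q → fillSkip q (does (2 * L t <? C t)) i) skip) e)))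

      C-step : ∀ {t} → Settled t → C (suc t) ≡ C t + skipped (lower A (hist t))
      C-step {t} (_ , O-now) = cong (λ O′ → C t + skipped (lower (G ─ O′) (hist t))) O-now

      L-step : ∀ {t} → Settled t → L (suc t) ≡ L t + chosen i (choice t)
      L-step {t} st = cong (L t +_) (i-follows st)

      -- C counts the skips of the lower plan, which occur infinitely often.
      C-eventually-above : ∀ n → Eventually (λ t → n ≤ C t)
      C-eventually-above = often-increasing→eventually-above C (λ t → m≤m+n _ _) λ t →
        let (t′ , le , skip , st) = often-∧-eventually (Guarantee.skips-often sub) settled t
        in t′ , le , trans (C-step st) (trans (cong (λ q → C t′ + skipped q) skip) (+-comm _ 1))

      -- i is extended infinitely often: otherwise its length freezes at some c, C exceeds
      -- 2·c, and the next skip of the lower plan would be filled with i.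
      i-often : Often (λ t → choice t ≡ just i)
      i-often = [ id , (λ never → ⊥-elim (refuted never)) ]′
                  (often-or-eventually-not em (λ t → choice t ≡ just i))
        where
        refuted : Eventually (λ t → ¬ choice t ≡ just i) → ⊥
        refuted never =
          let quiet = eventually-∧ settled never
              (c , frozen) = eventually-frozen aliceMoves i (proj₁ quiet , λ t le →
                               let (st , ¬i) = proj₂ quiet t le in trans (i-follows st) (chosen-miss i _ ¬i))
              (t , _ , skip , (st , ¬i) , L≡c , above) = often-∧-eventually (Guarantee.skips-often sub)
                (eventually-∧ quiet (eventually-∧ frozen (C-eventually-above (suc (2 * c))))) 0
          in ¬i (skip-filled st skip (≤-trans (≤-reflexive (cong (λ ℓ → suc (2 * ℓ)) L≡c)) above))

      i-infinite : Infinite aliceMoves i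
      i-infinite = often-extended→infinite aliceMoves i λ t →
        let (t′ , le , grows , st) = often-∧-eventually i-often settled t
        in t′ , le , trans (i-follows st) (trans (cong (chosen i) grows) (chosen-self i))

      skip≤chosen : ∀ {t} → Settled t → ¬ choice t ≡ nothing → skipped (lower A (hist t)) ≤ chosen i (choice t)
      skip≤chosen {t} st not-skipped = by-cases (lower A (hist t)) refl
        where
        by-cases : ∀ q → lower A (hist t) ≡ q → skipped q ≤ chosen i (choice t)
        by-cases (just _) _ = z≤n
        by-cases nothing skip = ≤-reflexive (sym (trans
          (cong (chosen i) (skip-filled st skip (skip-filled⁻ st skip not-skipped))) (chosen-self i)))

      -- The level skips infinitely often: otherwise, from some round s on, L grows at least
      -- as fast as C, which is incompatible with 2·L < C once C ≥ 2·C s.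
      level-skips : Often (λ t → choice t ≡ nothing)
      level-skips = [ id , (λ never → ⊥-elim (refuted never)) ]′
                      (often-or-eventually-not em (λ t → choice t ≡ nothing))
        where
        refuted : Eventually (λ t → ¬ choice t ≡ nothing) → ⊥
        refuted never =
          let (s , busy) = eventually-∧ settled never
              (t , _ , skip , (s≤t , st , not-skipped) , doubled) = often-∧-eventually (Guarantee.skips-often sub)
                (eventually-∧ (s , λ t le → le , busy t le) (C-eventually-above (2 * C s))) 0
          in slow-growth-absurd {C s} {L s} {C t} {L t} (grows-slower C L {s} (λ u le → C-slower (busy u le)) t s≤t)
                               (skip-filled⁻ st skip not-skipped) doubled
          where
          C-slower : ∀ {u} → Settled u × ¬ choice u ≡ nothing → C (suc u) + L u ≤ C u + L (suc u)
          C-slower {u} (st , not-skipped) = begin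
            C (suc u) + L u                              ≡⟨ cong (_+ L u) (C-step st) ⟩
            C u + skipped (lower A (hist u)) + L u       ≡⟨ xy∙z≈xz∙y (C u) _ (L u) ⟩
            C u + L u + skipped (lower A (hist u))       ≤⟨ +-monoʳ-≤ (C u + L u) (skip≤chosen st not-skipped) ⟩
            C u + L u + chosen i (choice u)              ≡⟨ +-assoc (C u) (L u) _ ⟩
            C u + (L u + chosen i (choice u))            ≡⟨ cong (C u +_) (L-step st) ⟨
            C u + L (suc u)                              ∎
            where open ≤-Reasoning

      guarantee : Guarantee (suc m) (raise m lower i G) G
      guarantee = record { skips-often = level-skips ; defeats = defeats }
        where
        defeats : ∀ {j} → j ∈ G → Infinite bobMoves j → ∃[ k ] (toℕ k < suc m × Infinite aliceMoves k × Overtakes j k)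
        defeats {j} j∈G inf with j ∈? O
        ... | no j∉O = widen (Guarantee.defeats sub (x∈p∧x∉q⇒x∈p─q j∈G j∉O) inf)
        ... | yes j∈O =
          let (s , settled-from) = settled
              (_ , O-now) = settled-from s ≤-refl
          in i , ≤-reflexive (cong suc i≡m) , i-infinite ,
             overtaken-elim s (∈-tabulate⁻ (λ j → overtaken (hist s) j i) (subst (j ∈_) (sym O-now) j∈O))

    guarantee : Guarantee (suc m) (raise m lower i G) G
    guarantee with ∣ A ∣ <? 2 ^ m
    ... | yes sparse = Sparse.guarantee sparse
    ... | no crowded = Crowded.guarantee crowded

  raise-correct : ∀ m lower i → toℕ i ≡ m → (∀ G h {k} → lower G h ≡ just k → toℕ k < m) →
                  Correct m lower → Correct (suc m) (raise m lower i)
  raise-correct m lower i i≡m range correct = Step.guarantee m lower i i≡m range correct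

  plan-correct : ∀ m m≤a → Correct m (plan m m≤a)
  plan-correct zero _ = empty-correct
  plan-correct (suc m) m<a = raise-correct m (plan m (<⇒≤ m<a)) (fromℕ< m<a) (toℕ-fromℕ< m<a)
                               (plan-range m (<⇒≤ m<a)) (plan-correct m (<⇒≤ m<a))

  -- Alice follows plan a ⊤ in every round and plays Bob's running total, so every
  -- infinite Bob sequence has once been longer than some infinite Alice sequence,
  -- and then does not exceed it.
  no-winner : b < 2 ^ a → ¬ BobWinsPlay σA σB
  no-winner b<2^a (j , inf-j , exceeds) =
    let (i , _ , inf-i , t , lag) = Guarantee.defeats top ∈⊤ inf-j
    in behind→not-exceeded bobMoves aliceMoves {t = t} alice-dominates inf-j inf-i lag (exceeds i inf-i)
    where
    top : Guarantee a (plan a ≤-refl ⊤) ⊤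
    top = plan-correct a ≤-refl ⊤ (subst (_< 2 ^ a) (sym (∣⊤∣≡n b)) b<2^a)
            (0 , λ t _ k _ → hit-toMove k (plan a ≤-refl ⊤ (hist t)) (sumB (hist t)))
    alice-dominates : ∀ r {i w} → aliceMoves r ≡ just (i , w) → total bobMoves r ≤ w
    alice-dominates r e = ≤-reflexive (trans (sym (sumB-hist r)) (toMove-value (plan a ≤-refl ⊤ (hist r)) _ e))

alice-wins : ∀ {a b} → ExcludedMiddle 0ℓ → b < 2 ^ a → AliceHasWinningStrategy a b
alice-wins {a} {b} em b<2^a = AliceStrategy.σA {a} {b} , λ σB → AliceWins.no-winner em σB b<2^a

lemma1 : ExcludedMiddle 0ℓ →
    (a b : ℕ) → 1 ≤ a → 1 ≤ b →
      ((2 ^ a ≤ b → BobHasWinningStrategy a b) ×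
       (b < 2 ^ a → AliceHasWinningStrategy a b))
lemma1 em a b _ _ = bob-wins em , alice-wins em
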